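{- Let $f:2^V\to\mathbb{R}$ admit an $(\eta,\beta)$-cost-sharing scheme $\chi$. Let $(f',V')$ be obtained by splitting each $i\in V$ into copies $C^i_1,\dots,C^i_{n_i}$, with $f'(S')=f(\Pi(S'))$. Let $A_1,\dots,A_K$ be a partition of $V'$ such that each $A_k$ contains at most one copy of each $i\in V$. Then there is a cost-sharing scheme $\chi'$ for $f'$ that is (a) $\beta$-budget balanced, (b) weakly $\eta$-summable, and (c) cross-monotone in the following restricted sense: $\chi'(i',S',\sigma_{S'})\ge\chi'(i',T',\sigma_{T'})$ for all $i'\in S'$, whenever $S'\subseteq T'\subseteq V'$, $\sigma_{S'}$ is the restriction of $\sigma_{T'}$ to $S'$, $\sigma_{T'}$ places all elements of $T'\cap A_K$ before those of $T'\cap A_{K-1}$, which come before those of $T'\cap A_{K-2}$, and so on down to $A_1$, and $S'$ is a partial prefix of $T'$, i.e. for some $k\in\{1,\dots,K\}$, $S'\subseteq A_K\cup\dots\cup A_k$ and $T'\setminus S'\subseteq A_k\cup\dots\cup A_1$.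
   Context: $\Pi(S')=\{i\in V: C^i_k\in S'\text{ for some }k\}$. A cost-sharing scheme for a set function $h$ on ground set $W$ is a function $\chi(i,S,\sigma_S)$ for $S\subseteq W$, ordering $\sigma_S$ of $S$, $i\in S$. $\beta$-budget balance: $h(S)\ge\sum_{i\in S}\chi(i,S,\sigma_S)\ge h(S)/\beta$ for all $S,\sigma_S$. Cross-monotonicity: $\chi(i,S,\sigma_S)\ge\chi(i,T,\sigma_T)$ whenever $i\in S\subseteq T$ and $\sigma_S$ is the restriction of $\sigma_T$. Weak $\eta$-summability: $\sum_{\ell=1}^{|S|}\chi(i_\ell,S_\ell,\sigma_{S_\ell})\le\eta h(S)$ for all $S,\sigma_S$, where $i_\ell$ is the $\ell$-th element under $\sigma_S$, $S_\ell$ the first $\ell$ elements and $\sigma_{S_\ell}$ the restricted ordering. An $(\eta,\beta)$-cost-sharing scheme satisfies all three. -}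

module Defs where

open import Level using (0ℓ)
open import Data.Nat using (ℕ; zero; suc)
open import Data.Fin using (Fin; _≟_; _≤_)
open import Data.Fin.Properties using (any?)
open import Data.Fin.Subset using (Subset; _∈_; _∉_; _⊆_; ⁅_⁆; _∪_; ⊥)
open import Data.Fin.Subset.Properties using (_∈?_)
open import Data.Bool using (Bool)
open import Data.Vec using (tabulate)
open import Data.List using (List; []; _∷_; _++_; [_]; foldr; map; filter)
open import Data.List.Relation.Unary.Unique.Propositional using (Unique)
open import Data.List.Relation.Unary.AllPairs using (AllPairs)
import Data.List.Membership.Propositional as LMem
open import Data.Product using (Σ; ∃; _×_; _,_)
open import Relation.Nullary using (¬_; does)
open import Relation.Nullary.Decidable using (_×-dec_)
open import Relation.Binary.PropositionalEquality using (_≡_; _≢_)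
open import Relation.Binary.Structures using (IsTotalOrder)
open import Algebra.Structures using (IsCommutativeRing)

-- Values of set functions: an arbitrary ordered field (ℝ is an instance).
-- Inverse is total with the convention 0⁻¹ = 0, so h(S)/β is h(S) * β⁻¹.

record OrderedField : Set₁ where
  infixl 6 _+_
  infixl 7 _*_
  infix 4 _≤ᶠ_
  field
    Carrier : Set
    _+_ _*_ : Carrier → Carrier → Carrier
    -_ : Carrier → Carrier
    _⁻¹ : Carrier → Carrier
    0# 1# : Carrier
    _≤ᶠ_ : Carrier → Carrier → Set
    isCommutativeRing : IsCommutativeRing _≡_ _+_ _*_ -_ 0# 1#
    isTotalOrder : IsTotalOrder _≡_ _≤ᶠ_
    +-monoˡ : ∀ {x y} z → x ≤ᶠ y → x + z ≤ᶠ y + z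
    *-nonneg : ∀ {x y} → 0# ≤ᶠ x → 0# ≤ᶠ y → 0# ≤ᶠ x * y
    0≢1 : 0# ≢ 1#
    ⁻¹-inverse : ∀ x → x ≢ 0# → x * (x ⁻¹) ≡ 1#
    ⁻¹-zero : 0# ⁻¹ ≡ 0#

  _/_ : Carrier → Carrier → Carrier
  x / y = x * (y ⁻¹)

  sumᶠ : List Carrier → Carrier
  sumᶠ = foldr _+_ 0#

-- Set functions and cost-sharing schemes on ground set Fin m.
-- An ordered set (S, σ_S) is a duplicate-free list σ; S is its element set.

toSubset : ∀ {m} → List (Fin m) → Subset m
toSubset = foldr (λ x s → ⁅ x ⁆ ∪ s) ⊥

restrict : ∀ {m} → Subset m → List (Fin m) → List (Fin m)
restrict S = filter (λ x → x ∈? S)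

module _ (F : OrderedField) where
  open OrderedField F

  SetFun : ℕ → Set
  SetFun m = Subset m → Carrier

  -- χ σ i = χ(i, S, σ_S) where S = elements of σ (meaningful for i ∈ S)
  Scheme : ℕ → Set
  Scheme m = List (Fin m) → Fin m → Carrier

  shareSum : ∀ {m} → Scheme m → List (Fin m) → Carrier
  shareSum χ σ = sumᶠ (map (χ σ) σ)

  BudgetBalanced : ∀ {m} → Carrier → SetFun m → Scheme m → Set
  BudgetBalanced β h χ = ∀ σ → Unique σ →
    (shareSum χ σ ≤ᶠ h (toSubset σ)) × (h (toSubset σ) / β ≤ᶠ shareSum χ σ)

  CrossMonotone : ∀ {m} → Scheme m → Set
  CrossMonotone χ = ∀ σT → Unique σT → ∀ S → S ⊆ toSubset σT →
    ∀ i → i ∈ S → χ σT i ≤ᶠ χ (restrict S σT) i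

  -- Σ_{ℓ=1}^{|S|} χ(i_ℓ, S_ℓ, σ_{S_ℓ}); 'pre' is the prefix already seen
  prefixShares : ∀ {m} → Scheme m → List (Fin m) → List (Fin m) → Carrier
  prefixShares χ pre [] = 0#
  prefixShares χ pre (x ∷ xs) = χ (pre ++ [ x ]) x + prefixShares χ (pre ++ [ x ]) xs

  WeaklySummable : ∀ {m} → Carrier → SetFun m → Scheme m → Set
  WeaklySummable η h χ = ∀ σ → Unique σ → prefixShares χ [] σ ≤ᶠ η * h (toSubset σ)

  CostSharingScheme : ∀ {m} → Carrier → Carrier → SetFun m → Scheme m → Set
  CostSharingScheme η β h χ =
    BudgetBalanced β h χ × CrossMonotone χ × WeaklySummable η h χ

-- Splitting: V' = Fin m, each i' ∈ V' is a copy of π i' ∈ V = Fin n.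
-- Π(S') = image of S' under π.

image : ∀ {m n} → (Fin m → Fin n) → Subset m → Subset n
image π S = tabulate (λ j → does (any? (λ i → (i ∈? S) ×-dec (π i ≟ j))))

module _ (F : OrderedField) where
  open OrderedField F

  splitFun : ∀ {m n} → (Fin m → Fin n) → SetFun F n → SetFun F m
  splitFun π f S' = f (image π S')

  -- Partition A_1..A_K of V' given by block index (Fin K, index k-1 ↔ A_k);
  -- each block contains at most one copy of each i ∈ V.
  AtMostOneCopyPerBlock : ∀ {m n K} → (Fin m → Fin n) → (Fin m → Fin K) → Set
  AtMostOneCopyPerBlock π part = ∀ x y → part x ≡ part y → π x ≡ π y → x ≡ y

  BlockOrdered : ∀ {m K} → (Fin m → Fin K) → List (Fin m) → Set
  BlockOrdered part σ = AllPairs (λ x y → part y ≤ part x) σ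

  PartialPrefix : ∀ {m K} → (Fin m → Fin K) → Subset m → Subset m → Set
  PartialPrefix {K = K} part S T = Σ (Fin K) λ k →
    (∀ x → x ∈ S → k ≤ part x) × (∀ x → x ∈ T → x ∉ S → part x ≤ k)

  RestrictedCrossMonotone : ∀ {m K} → (Fin m → Fin K) → Scheme F m → Set
  RestrictedCrossMonotone part χ = ∀ σT → Unique σT → BlockOrdered part σT →
    ∀ S → S ⊆ toSubset σT → PartialPrefix part S (toSubset σT) →
    ∀ i → i ∈ S → χ σT i ≤ᶠ χ (restrict S σT) i

module Submission where

-- The scheme 'split χ' charges, in an
-- ordered set σ of copies, only the first copy of each original element (its
-- representative; 'reps σ' lists them): the representative of i pays
-- χ(i, σ_Π), where σ_Π = map π (reps σ) is Π(σ) ordered by representatives;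
-- every other copy pays 0.

open import Defs
open import Data.Nat using (ℕ)
open import Data.Fin using (Fin)
open import Data.Product using (Σ; _×_; ∃₂; _,_; proj₁)
open import Data.Sum using (inj₁; inj₂)
open import Data.Empty using (⊥-elim)
open import Data.Unit using (tt)
open import Function using (_∘_)
open import Data.Bool using (T; true)
open import Data.List using (List; []; _∷_; _++_; [_]; map; filter)
open import Data.List.Properties
  using (++-assoc; ++-identityʳ; map-++; map-∘; map-cong-local; filter-accept; filter-reject; filter-++)
open import Data.List.Relation.Unary.Any as Any using (Any; here; there; any?)
import Data.List.Relation.Unary.Any.Properties as Anyₚ
open import Data.List.Relation.Unary.All as All using (All; []; _∷_)
open import Data.List.Relation.Unary.All.Properties using (All¬⇒¬Any)
open import Data.List.Relation.Unary.AllPairs as AllPairs using (AllPairs; []; _∷_)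
import Data.List.Relation.Unary.AllPairs.Properties as AllPairsₚ
open import Data.List.Relation.Unary.Unique.Propositional using (Unique)
open import Data.List.Relation.Binary.Sublist.Propositional
  using ([]; _∷_; _∷ʳ_) renaming (_⊆_ to _⊑_; lookup to ⊑-lookup)
open import Data.List.Membership.Propositional using () renaming (_∈_ to _∈ˡ_; _∉_ to _∉ˡ_)
open import Data.List.Membership.Propositional.Properties using (∈-++⁺ʳ; ∈-++⁻; ∈-map⁻; ∈-filter⁺; ∈-filter⁻)
open import Data.List.Membership.DecPropositional as DecMembership using ()
import Data.Fin as Fin
import Data.Fin.Properties as Finₚ
open import Data.Fin.Subset using (Subset; ⁅_⁆; _∈_; _∉_; _⊆_)
open import Data.Fin.Subset.Properties using (_∈?_; ⊆-antisym; x∈p∪q⁺; x∈p∪q⁻; x∈⁅x⁆; x∈⁅y⁆⇒x≡y; ∉⊥)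
open import Data.Vec.Properties using (lookup∘tabulate; lookup⇒[]=; []=⇒lookup)
open import Relation.Nullary using (¬_; Dec; yes; no)
open import Relation.Nullary.Decidable using (dec-true; toWitness; isYes; isYes≗does; _×-dec_)
open import Relation.Unary using (Decidable)
open import Relation.Binary.Definitions using (DecidableEquality)
open import Relation.Binary.Structures using (IsTotalOrder)
open import Relation.Binary.PropositionalEquality
  using (_≡_; _≢_; refl; sym; trans; cong; cong₂; subst; subst₂; module ≡-Reasoning)
open import Algebra.Structures using (IsCommutativeRing)

allPairs-before : ∀ {A : Set} {R : A → A → Set} pre {x xs} →
  AllPairs R (pre ++ x ∷ xs) → All (λ y → R y x) pre
allPairs-before [] _ = []
allPairs-before (y ∷ pre) (ry ∷ rs) = All.lookup ry (∈-++⁺ʳ pre (here refl)) ∷ allPairs-before pre rs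

unique-before : ∀ {A : Set} (pre : List A) {x xs} → Unique (pre ++ x ∷ xs) → x ∉ˡ pre
unique-before pre u = All¬⇒¬Any (All.map (_∘ sym) (allPairs-before pre u))

allPairs-++⁻ʳ : ∀ {A : Set} {R : A → A → Set} pre {xs} → AllPairs R (pre ++ xs) → AllPairs R xs
allPairs-++⁻ʳ [] rs = rs
allPairs-++⁻ʳ (_ ∷ pre) (_ ∷ rs) = allPairs-++⁻ʳ pre rs

allPairs-weaken : ∀ {A : Set} {P : A → Set} {R R' : A → A → Set} →
  (∀ {a b} → P a → P b → R a b → R' a b) → ∀ {xs} → All P xs → AllPairs R xs → AllPairs R' xs
allPairs-weaken f [] [] = []
allPairs-weaken f (pa ∷ ps) (ra ∷ rs) =
  All.zipWith (λ (pb , r) → f pa pb r) (ps , ra) ∷ allPairs-weaken f ps rs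

filter-map-local : ∀ {A B : Set} (f : A → B) {P : A → Set} {Q : B → Set}
  (P? : Decidable P) (Q? : Decidable Q) xs →
  All (λ x → (P x → Q (f x)) × (Q (f x) → P x)) xs →
  filter Q? (map f xs) ≡ map f (filter P? xs)
filter-map-local f P? Q? [] [] = refl
filter-map-local f P? Q? (x ∷ xs) ((to , from) ∷ agree) with P? x
... | yes Px = trans (filter-accept Q? (to Px)) (cong (f x ∷_) (filter-map-local f P? Q? xs agree))
... | no ¬Px = trans (filter-reject Q? (¬Px ∘ from)) (filter-map-local f P? Q? xs agree)

module Representatives {A B : Set} (_≟_ : DecidableEquality B) (κ : A → B) where

  Seen : List A → A → Set
  Seen pre x = Any (λ y → κ y ≡ κ x) pre

  seen? : ∀ pre x → Dec (Seen pre x)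
  seen? pre x = any? (λ y → κ y ≟ κ x) pre

  firsts : List A → List A → List A
  firsts pre [] = []
  firsts pre (x ∷ xs) with seen? pre x
  ... | yes _ = firsts (pre ++ [ x ]) xs
  ... | no _ = x ∷ firsts (pre ++ [ x ]) xs

  firsts-++ : ∀ pre xs ys → firsts pre (xs ++ ys) ≡ firsts pre xs ++ firsts (pre ++ xs) ys
  firsts-++ pre [] ys = cong (λ p → firsts p ys) (sym (++-identityʳ pre))
  firsts-++ pre (x ∷ xs) ys with seen? pre x
    | trans (firsts-++ (pre ++ [ x ]) xs ys)
            (cong (λ p → firsts (pre ++ [ x ]) xs ++ firsts p ys) (++-assoc pre [ x ] xs))
  ... | yes _ | ih = ih
  ... | no _ | ih = cong (x ∷_) ih

  firsts-⊑ : ∀ pre xs → firsts pre xs ⊑ xs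
  firsts-⊑ pre [] = []
  firsts-⊑ pre (x ∷ xs) with seen? pre x
  ... | yes _ = x ∷ʳ firsts-⊑ (pre ++ [ x ]) xs
  ... | no _ = refl ∷ firsts-⊑ (pre ++ [ x ]) xs

  FirstOccurrence : List A → List A → A → Set
  FirstOccurrence pre xs y = ∃₂ λ us vs → xs ≡ us ++ y ∷ vs × ¬ Seen (pre ++ us) y

  firstOccurrence-cons : ∀ pre x {xs y} →
    FirstOccurrence (pre ++ [ x ]) xs y → FirstOccurrence pre (x ∷ xs) y
  firstOccurrence-cons pre x {y = y} (us , vs , refl , unseen) =
    x ∷ us , vs , refl , unseen ∘ subst (λ l → Seen l y) (sym (++-assoc pre [ x ] us))

  firsts-first : ∀ pre xs {y} → y ∈ˡ firsts pre xs → FirstOccurrence pre xs y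
  firsts-first pre (x ∷ xs) {y} y∈ with seen? pre x
  ... | yes _ = firstOccurrence-cons pre x (firsts-first (pre ++ [ x ]) xs y∈)
  ... | no unseen with y∈
  ...   | here refl = [] , xs , refl , unseen ∘ subst (λ l → Seen l y) (++-identityʳ pre)
  ...   | there y∈′ = firstOccurrence-cons pre x (firsts-first (pre ++ [ x ]) xs y∈′)

  firsts-unseen : ∀ pre xs {y} → y ∈ˡ firsts pre xs → ¬ Seen pre y
  firsts-unseen pre xs y∈ with firsts-first pre xs y∈
  ... | _ , _ , _ , unseen = unseen ∘ Anyₚ.++⁺ˡ

  firsts-distinct : ∀ pre xs → AllPairs (λ a b → κ a ≢ κ b) (firsts pre xs)
  firsts-distinct pre [] = []
  firsts-distinct pre (x ∷ xs) with seen? pre x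
  ... | yes _ = firsts-distinct (pre ++ [ x ]) xs
  ... | no _ = All.tabulate (λ y∈ e → firsts-unseen (pre ++ [ x ]) xs y∈ (Anyₚ.++⁺ʳ pre (here e)))
             ∷ firsts-distinct (pre ++ [ x ]) xs

  firsts-cover : ∀ pre xs {b} →
    Any (λ y → κ y ≡ b) (pre ++ xs) → Any (λ y → κ y ≡ b) (pre ++ firsts pre xs)
  firsts-cover pre [] p = p
  firsts-cover pre (x ∷ xs) {b} p with seen? pre x
    | firsts-cover (pre ++ [ x ]) xs (subst (Any (λ y → κ y ≡ b)) (sym (++-assoc pre [ x ] xs)) p)
  ... | no _ | q = subst (Any (λ y → κ y ≡ b)) (++-assoc pre [ x ] _) q
  ... | yes seen | q with Anyₚ.++⁻ (pre ++ [ x ]) q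
  ...   | inj₂ q′ = Anyₚ.++⁺ʳ pre q′
  ...   | inj₁ q′ with Anyₚ.++⁻ pre q′
  ...     | inj₁ q″ = Anyₚ.++⁺ˡ q″
  ...     | inj₂ (here e) = Anyₚ.++⁺ˡ (Any.map (λ e′ → trans e′ e) seen)

  -- Filtering by a predicate P commutes with taking representatives,
  -- provided in each key class the P-elements precede the others.
  module Filtering {P : A → Set} (P? : Decidable P) where

    PFirst : List A → Set
    PFirst = AllPairs (λ y x → ¬ P y → P x → κ y ≢ κ x)

    seen-filter : ∀ pre {x} → All (λ y → ¬ P y → P x → κ y ≢ κ x) pre → P x →
      Seen pre x → Seen (filter P? pre) x
    seen-filter pre ordered Px s with Anyₚ.filter⁺ P? s
    ... | inj₁ s′ = s′
    ... | inj₂ ¬Pw with All.lookupAny ordered s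
    ...   | q , e = ⊥-elim (q ¬Pw Px e)

    filter-snoc-accept : ∀ pre {x} → P x → filter P? (pre ++ [ x ]) ≡ filter P? pre ++ [ x ]
    filter-snoc-accept pre {x} Px =
      trans (filter-++ P? pre [ x ]) (cong (filter P? pre ++_) (filter-accept P? Px))

    filter-snoc-reject : ∀ pre {x} → ¬ P x → filter P? (pre ++ [ x ]) ≡ filter P? pre
    filter-snoc-reject pre {x} ¬Px =
      trans (filter-++ P? pre [ x ]) (trans (cong (filter P? pre ++_) (filter-reject P? ¬Px)) (++-identityʳ _))

    firsts-filter : ∀ pre xs → PFirst (pre ++ xs) →
      firsts (filter P? pre) (filter P? xs) ≡ filter P? (firsts pre xs)
    firsts-filter pre [] _ = refl
    firsts-filter pre (x ∷ xs) ordered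
      with P? x | seen? pre x
         | firsts-filter (pre ++ [ x ]) xs (subst PFirst (sym (++-assoc pre [ x ] xs)) ordered)
    ... | no ¬Px | yes _ | ih =
      trans (cong (λ p → firsts p (filter P? xs)) (sym (filter-snoc-reject pre ¬Px))) ih
    ... | no ¬Px | no _ | ih =
      trans (trans (cong (λ p → firsts p (filter P? xs)) (sym (filter-snoc-reject pre ¬Px))) ih)
            (sym (filter-reject P? ¬Px))
    ... | yes Px | s | ih with seen? (filter P? pre) x
    firsts-filter pre (x ∷ xs) ordered | yes Px | yes _ | ih | yes _ =
      trans (cong (λ p → firsts p (filter P? xs)) (sym (filter-snoc-accept pre Px))) ih
    firsts-filter pre (x ∷ xs) ordered | yes Px | no _ | ih | no _ =
      trans (cong (x ∷_) (trans (cong (λ p → firsts p (filter P? xs)) (sym (filter-snoc-accept pre Px))) ih))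
            (sym (filter-accept P? Px))
    firsts-filter pre (x ∷ xs) ordered | yes Px | yes s | _ | no ¬s′ =
      ⊥-elim (¬s′ (seen-filter pre (allPairs-before pre ordered) Px s))
    firsts-filter pre (x ∷ xs) ordered | yes Px | no ¬s | _ | yes s′ = ⊥-elim (¬s (Anyₚ.filter⁻ P? s′))

    -- If the key class of a representative y meets P, then P y: a P-element
    -- of the class cannot come before y, and cannot come after y unless P y.
    firsts-P-class : ∀ pre xs {y z} → PFirst (pre ++ xs) → y ∈ˡ firsts pre xs →
      z ∈ˡ pre ++ xs → P z → κ z ≡ κ y → P y
    firsts-P-class pre xs {y} {z} ordered y∈ z∈ Pz e with firsts-first pre xs y∈
    ... | us , vs , refl , unseen with P? y
    ...   | yes Py = Py
    ...   | no ¬Py with ∈-++⁻ (pre ++ us) (subst (z ∈ˡ_) (sym (++-assoc pre us (y ∷ vs))) z∈)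
    ...     | inj₁ z∈pre = ⊥-elim (unseen (Any.map (λ { refl → e }) z∈pre))
    ...     | inj₂ (here refl) = ⊥-elim (¬Py Pz)
    ...     | inj₂ (there z∈vs) = ⊥-elim (All.lookup later z∈vs ¬Py Pz (sym e))
      where
      later : All (λ x → ¬ P y → P x → κ y ≢ κ x) vs
      later = AllPairs.head
        (allPairs-++⁻ʳ (pre ++ us) (subst PFirst (sym (++-assoc pre us (y ∷ vs))) ordered))

toSubset-∈⁺ : ∀ {k} {x : Fin k} σ → x ∈ˡ σ → x ∈ toSubset σ
toSubset-∈⁺ (y ∷ ys) (here refl) = x∈p∪q⁺ (inj₁ (x∈⁅x⁆ y))
toSubset-∈⁺ (y ∷ ys) (there x∈) = x∈p∪q⁺ (inj₂ (toSubset-∈⁺ ys x∈))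

toSubset-∈⁻ : ∀ {k} {x : Fin k} σ → x ∈ toSubset σ → x ∈ˡ σ
toSubset-∈⁻ [] x∈ = ⊥-elim (∉⊥ x∈)
toSubset-∈⁻ (y ∷ ys) x∈ with x∈p∪q⁻ ⁅ y ⁆ (toSubset ys) x∈
... | inj₁ x∈y = here (x∈⁅y⁆⇒x≡y y x∈y)
... | inj₂ x∈ys = there (toSubset-∈⁻ ys x∈ys)

module Image {m n : ℕ} (π : Fin m → Fin n) where

  InImage : Subset m → Fin n → Set
  InImage S j = Σ (Fin m) λ i → i ∈ S × π i ≡ j

  inImage? : ∀ S j → Dec (InImage S j)
  inImage? S j = Finₚ.any? (λ i → (i ∈? S) ×-dec (π i Fin.≟ j))

  image-∈⁺ : ∀ S {i} → i ∈ S → π i ∈ image π S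
  image-∈⁺ S {i} i∈S = lookup⇒[]= (π i) (image π S)
    (trans (lookup∘tabulate _ (π i)) (dec-true (inImage? S (π i)) (i , i∈S , refl)))

  image-∈⁻ : ∀ S {j} → j ∈ image π S → InImage S j
  image-∈⁻ S {j} j∈ = toWitness {a? = inImage? S j} (subst T (sym decided) tt)
    where
    decided : isYes (inImage? S j) ≡ true
    decided = trans (isYes≗does _) (trans (sym (lookup∘tabulate _ j)) ([]=⇒lookup j∈))

  image-mono : ∀ {S T} → S ⊆ T → image π S ⊆ image π T
  image-mono {S} {T} S⊆T j∈ with image-∈⁻ S j∈
  ... | i , i∈S , refl = image-∈⁺ T (S⊆T i∈S)

-- Over a duplicate-free σ, a function vanishing off a sublist L has the same
-- sum over σ as over L; this is why only representatives' shares count.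
module Sums (F : OrderedField) where
  open OrderedField F
  open IsCommutativeRing isCommutativeRing using (+-identityˡ)

  sum-sublist : ∀ {A : Set} (h : A → Carrier) {L σ} → L ⊑ σ → Unique σ →
    (∀ {y} → y ∈ˡ σ → y ∉ˡ L → h y ≡ 0#) → sumᶠ (map h σ) ≡ sumᶠ (map h L)
  sum-sublist h [] [] vanish = refl
  sum-sublist h {L} {x ∷ σ} (x ∷ʳ L⊑σ) (x∉σ ∷ u) vanish = begin
    h x + sumᶠ (map h σ)    ≡⟨ cong (_+ sumᶠ (map h σ)) (vanish (here refl) (All¬⇒¬Any x∉σ ∘ ⊑-lookup L⊑σ)) ⟩
    0# + sumᶠ (map h σ)     ≡⟨ +-identityˡ _ ⟩
    sumᶠ (map h σ)          ≡⟨ sum-sublist h L⊑σ u (vanish ∘ there) ⟩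
    sumᶠ (map h L)          ∎
    where open ≡-Reasoning
  sum-sublist h {x ∷ L} {x ∷ σ} (refl ∷ L⊑σ) (x∉σ ∷ u) vanish = cong (h _ +_) (sum-sublist h L⊑σ u vanish′)
    where
    vanish′ : ∀ {y} → y ∈ˡ σ → y ∉ˡ L → h y ≡ 0#
    vanish′ y∈σ y∉L = vanish (there y∈σ) λ { (here refl) → All¬⇒¬Any x∉σ y∈σ ; (there y∈L) → y∉L y∈L }

module SplitScheme (F : OrderedField) {n m : ℕ} (π : Fin m → Fin n) where
  open OrderedField F
  open IsCommutativeRing isCommutativeRing using (+-identityˡ)
  open Representatives Fin._≟_ π
  open Image π
  open Sums F
  open DecMembership (Fin._≟_ {m}) using () renaming (_∈?_ to _∈ˡ?_)
  open ≡-Reasoning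

  reps : List (Fin m) → List (Fin m)
  reps = firsts []

  reps-unique : ∀ σ → Unique (map π (reps σ))
  reps-unique σ = AllPairsₚ.map⁺ (firsts-distinct [] σ)

  reps-image : ∀ σ → toSubset (map π (reps σ)) ≡ image π (toSubset σ)
  reps-image σ = ⊆-antisym sound complete
    where
    sound : toSubset (map π (reps σ)) ⊆ image π (toSubset σ)
    sound j∈ with ∈-map⁻ π (toSubset-∈⁻ (map π (reps σ)) j∈)
    ... | y , y∈ , refl = image-∈⁺ (toSubset σ) (toSubset-∈⁺ σ (⊑-lookup (firsts-⊑ [] σ) y∈))
    complete : image π (toSubset σ) ⊆ toSubset (map π (reps σ))
    complete j∈ with image-∈⁻ (toSubset σ) j∈
    ... | i , i∈σ , refl = toSubset-∈⁺ (map π (reps σ))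
      (Anyₚ.map⁺ (Any.map sym (firsts-cover [] σ (Any.map (cong π ∘ sym) (toSubset-∈⁻ σ i∈σ)))))

  module _ (χ : Scheme F n) where

    split : Scheme F m
    split σ x with x ∈ˡ? reps σ
    ... | yes _ = χ (map π (reps σ)) (π x)
    ... | no _ = 0#

    split-rep : ∀ σ {x} → x ∈ˡ reps σ → split σ x ≡ χ (map π (reps σ)) (π x)
    split-rep σ {x} x∈ with x ∈ˡ? reps σ
    ... | yes _ = refl
    ... | no x∉ = ⊥-elim (x∉ x∈)

    split-nonrep : ∀ σ {x} → x ∉ˡ reps σ → split σ x ≡ 0#
    split-nonrep σ {x} x∉ with x ∈ˡ? reps σ
    ... | yes x∈ = ⊥-elim (x∉ x∈)
    ... | no _ = refl

    shareSum-split : ∀ σ → Unique σ → shareSum F split σ ≡ shareSum F χ (map π (reps σ))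
    shareSum-split σ u = begin
      sumᶠ (map (split σ) σ)         ≡⟨ sum-sublist (split σ) (firsts-⊑ [] σ) u (λ _ → split-nonrep σ) ⟩
      sumᶠ (map (split σ) (reps σ))  ≡⟨ cong sumᶠ (map-cong-local (All.tabulate (split-rep σ))) ⟩
      sumᶠ (map (χ σΠ ∘ π) (reps σ)) ≡⟨ cong sumᶠ (map-∘ (reps σ)) ⟩
      sumᶠ (map (χ σΠ) σΠ)           ∎
      where
      σΠ : List (Fin n)
      σΠ = map π (reps σ)

    -- Adding x to the prefix either repeats a seen original (x pays 0 and σ_Π
    -- is unchanged) or appends π x to σ_Π (x pays what χ charges π x there).
    prefixShares-split : ∀ pre xs → Unique (pre ++ xs) →
      prefixShares F split pre xs ≡ prefixShares F χ (map π (reps pre)) (map π (firsts pre xs))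
    prefixShares-split pre [] _ = refl
    prefixShares-split pre (x ∷ xs) u
      with seen? pre x | firsts-++ [] pre [ x ]
         | prefixShares-split (pre ++ [ x ]) xs (subst Unique (sym (++-assoc pre [ x ] xs)) u)
    ... | yes _ | reps-snoc | ih = begin
      split (pre ++ [ x ]) x + prefixShares F split (pre ++ [ x ]) xs
        ≡⟨ cong₂ _+_ (split-nonrep (pre ++ [ x ]) x∉) ih ⟩
      0# + prefixShares F χ (map π (reps (pre ++ [ x ]))) (map π (firsts (pre ++ [ x ]) xs))
        ≡⟨ +-identityˡ _ ⟩
      prefixShares F χ (map π (reps (pre ++ [ x ]))) (map π (firsts (pre ++ [ x ]) xs))
        ≡⟨ cong (λ l → prefixShares F χ (map π l) (map π (firsts (pre ++ [ x ]) xs)))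
                (trans reps-snoc (++-identityʳ _)) ⟩
      prefixShares F χ (map π (reps pre)) (map π (firsts (pre ++ [ x ]) xs))
        ∎
      where
      x∉ : x ∉ˡ reps (pre ++ [ x ])
      x∉ x∈ = unique-before pre u
        (⊑-lookup (firsts-⊑ [] pre) (subst (x ∈ˡ_) (trans reps-snoc (++-identityʳ _)) x∈))
    ... | no _ | reps-snoc | ih =
      cong₂ _+_ (trans (split-rep (pre ++ [ x ]) x∈) (cong (λ l → χ l (π x)) σΠ-snoc))
                (trans ih (cong (λ l → prefixShares F χ l (map π (firsts (pre ++ [ x ]) xs))) σΠ-snoc))
      where
      σΠ-snoc : map π (reps (pre ++ [ x ])) ≡ map π (reps pre) ++ [ π x ]
      σΠ-snoc = trans (cong (map π) reps-snoc) (map-++ π (reps pre) [ x ])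
      x∈ : x ∈ˡ reps (pre ++ [ x ])
      x∈ = subst (x ∈ˡ_) (sym reps-snoc) (∈-++⁺ʳ (reps pre) (here refl))

    -- Both transfer along share sums and prefix shares, since f'(σ) = f(σ_Π).
    split-budgetBalanced : ∀ {β} (f : SetFun F n) → BudgetBalanced F β f χ →
      BudgetBalanced F β (splitFun F π f) split
    split-budgetBalanced {β} f bb σ u with bb (map π (reps σ)) (reps-unique σ)
    ... | upper , lower =
      subst₂ _≤ᶠ_ (sym (shareSum-split σ u)) (cong f (reps-image σ)) upper ,
      subst₂ _≤ᶠ_ (cong (λ s → f s / β) (reps-image σ)) (sym (shareSum-split σ u)) lower

    split-weaklySummable : ∀ {η} (f : SetFun F n) → WeaklySummable F η f χ →
      WeaklySummable F η (splitFun F π f) split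
    split-weaklySummable {η} f ws σ u =
      subst₂ _≤ᶠ_ (sym (prefixShares-split [] σ u)) (cong (λ s → η * f s) (reps-image σ))
        (ws (map π (reps σ)) (reps-unique σ))

    -- If, within each class of copies, the S-copies come first in σ, then
    -- restricting σ to S restricts σ_Π to Π(S), so χ's cross-monotonicity transfers.
    module _ (S : Subset m) where
      open Filtering (_∈? S)

      restrict-reps : ∀ σ → PFirst σ → S ⊆ toSubset σ →
        map π (reps (restrict S σ)) ≡ restrict (image π S) (map π (reps σ))
      restrict-reps σ ordered S⊆σ = begin
        map π (reps (restrict S σ))           ≡⟨ cong (map π) (firsts-filter [] σ ordered) ⟩
        map π (filter (_∈? S) (reps σ))       ≡⟨ filter-map-local π (_∈? S) (_∈? image π S) (reps σ) (All.tabulate agree) ⟨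
        restrict (image π S) (map π (reps σ)) ∎
        where
        agree : ∀ {y} → y ∈ˡ reps σ → (y ∈ S → π y ∈ image π S) × (π y ∈ image π S → y ∈ S)
        agree y∈ = image-∈⁺ S , λ πy∈ → let (z , z∈S , e) = image-∈⁻ S πy∈ in
          firsts-P-class [] σ ordered y∈ (toSubset-∈⁻ σ (S⊆σ z∈S)) z∈S e

      split-crossMonotone : CrossMonotone F χ → ∀ σ → PFirst σ → S ⊆ toSubset σ →
        ∀ i → i ∈ S → split σ i ≤ᶠ split (restrict S σ) i
      split-crossMonotone cm σ ordered S⊆σ i i∈S = by-cases (i ∈ˡ? reps σ)
        where
        reps-restrict : reps (restrict S σ) ≡ filter (_∈? S) (reps σ)
        reps-restrict = firsts-filter [] σ ordered
        by-cases : Dec (i ∈ˡ reps σ) → split σ i ≤ᶠ split (restrict S σ) i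
        by-cases (yes i∈) = subst₂ _≤ᶠ_ (sym (split-rep σ i∈)) (sym restricted-share)
          (cm (map π (reps σ)) (reps-unique σ) (image π S)
              (subst (image π S ⊆_) (sym (reps-image σ)) (image-mono S⊆σ)) (π i) (image-∈⁺ S i∈S))
          where
          restricted-share : split (restrict S σ) i ≡ χ (restrict (image π S) (map π (reps σ))) (π i)
          restricted-share = trans
            (split-rep (restrict S σ) (subst (i ∈ˡ_) (sym reps-restrict) (∈-filter⁺ (_∈? S) i∈ i∈S)))
            (cong (λ l → χ l (π i)) (restrict-reps σ ordered S⊆σ))
        by-cases (no i∉) = subst₂ _≤ᶠ_ (sym (split-nonrep σ i∉)) (sym (split-nonrep (restrict S σ) i∉′))
          (IsTotalOrder.refl isTotalOrder)
          where
          i∉′ : i ∉ˡ reps (restrict S σ)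
          i∉′ = i∉ ∘ proj₁ ∘ ∈-filter⁻ (_∈? S) ∘ subst (i ∈ˡ_) reps-restrict

  -- In a block-ordered σ_T with S a partial prefix, a non-S copy y placed
  -- before an S-copy x lies in a block at or below A_k and x in one at or
  -- above it, while the order puts x's block at or below y's: both lie in the
  -- same block, so they are copies of different originals.
  partialPrefix-PFirst : ∀ {K} (part : Fin m → Fin K) → AtMostOneCopyPerBlock F π part →
    ∀ σ S → BlockOrdered F part σ → PartialPrefix F part S (toSubset σ) →
    Filtering.PFirst (_∈? S) σ
  partialPrefix-PFirst part oneCopy σ S blocks (_ , S-above , rest-below) =
    allPairs-weaken same-class (All.tabulate (toSubset-∈⁺ σ)) blocks
    where
    same-class : ∀ {y x} → y ∈ toSubset σ → x ∈ toSubset σ → part x Fin.≤ part y →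
      y ∉ S → x ∈ S → π y ≢ π x
    same-class {y} {x} y∈σ _ x≤y y∉S x∈S πy≡πx =
      y∉S (subst (_∈ S) (sym (oneCopy y x same-block πy≡πx)) x∈S)
      where
      same-block : part y ≡ part x
      same-block = Finₚ.≤-antisym (Finₚ.≤-trans (rest-below y y∈σ y∉S) (S-above x x∈S)) x≤y

  split-restrictedCrossMonotone : ∀ {K} (part : Fin m → Fin K) {χ : Scheme F n} →
    AtMostOneCopyPerBlock F π part → CrossMonotone F χ → RestrictedCrossMonotone F part (split χ)
  split-restrictedCrossMonotone part {χ} oneCopy cm σ _ blocks S S⊆σ prefix =
    split-crossMonotone χ S cm σ (partialPrefix-PFirst part oneCopy σ S blocks prefix) S⊆σ

lemma3 : (F : OrderedField) → (η β : OrderedField.Carrier F) →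
    {n m K : ℕ} → (f : SetFun F n) → (χ : Scheme F n) →
    CostSharingScheme F η β f χ →
    (π : Fin m → Fin n) → (part : Fin m → Fin K) →
    AtMostOneCopyPerBlock F π part →
    Σ (Scheme F m) λ χ' →
    BudgetBalanced F β (splitFun F π f) χ' ×
    WeaklySummable F η (splitFun F π f) χ' ×
    RestrictedCrossMonotone F part χ'
lemma3 F _ _ f χ (budget , crossMonotone , summable) π part oneCopy =
  split χ ,
  split-budgetBalanced χ f budget ,
  split-weaklySummable χ f summable ,
  split-restrictedCrossMonotone part oneCopy crossMonotone
  where open SplitScheme F π
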